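{- For every positive integer $n$ and complex $q$ with $|q|<1$, $$\sum_{j=1}^n\frac{(-1)^{j-1}q^{\binom{n-j}2}(q;q)_{n+j}(q;q)_{j-1}}{(q;q)_{n-j}(q;q)_{2j}}= q^{\binom{n}2}\left\{ \sum _{j=0}^{\lfloor\frac{n}2\rfloor}\sum_{i=-j+1}^j q^{j^2-i^2} + \sum _{j=0}^{\lfloor\frac{n-1}2\rfloor}\sum_{i=-j}^j q^{j^2+j-i^2-i}\right\}.$$
   Context: $(a;q)_0=1$ and $(a;q)_n=\prod_{j=0}^{n-1}(1-aq^j)$ for $n\ge1$. A sum whose upper limit is smaller than its lower limit is zero. -}

module Defs where

open import Level using (Level)
open import Algebra.Bundles using (CommutativeRing)
open import Data.Nat using (ℕ; zero; suc; _∸_)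
import Data.Nat as ℕ
open import Data.Integer as ℤ using (ℤ; +_; -[1+_])

module _ {c ℓ : Level} (R : CommutativeRing c ℓ) where
  open CommutativeRing R

  pow : Carrier → ℕ → Carrier
  pow x zero = 1#
  pow x (suc k) = x * pow x k

  sumLen : ℕ → ℕ → (ℕ → Carrier) → Carrier
  sumLen start zero f = 0#
  sumLen start (suc len) f = f start + sumLen (suc start) len f

  -- Σ_{k=a}^{b} f k  (zero when b < a)
  sumFromTo : ℕ → ℕ → (ℕ → Carrier) → Carrier
  sumFromTo a b f = sumLen a (suc b ∸ a) f

  prodLen : ℕ → ℕ → (ℕ → Carrier) → Carrier
  prodLen start zero f = 1#
  prodLen start (suc len) f = f start * prodLen (suc start) len f

  qPoch : Carrier → Carrier → ℕ → Carrier
  qPoch a q m = prodLen 0 m (λ j → 1# - a * pow q j)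

  countℤ : ℤ → ℤ → ℕ
  countℤ a b with (b ℤ.+ ℤ.1ℤ) ℤ.- a
  ... | + k = k
  ... | -[1+ _ ] = 0

  sumℤ : ℤ → ℤ → (ℤ → Carrier) → Carrier
  sumℤ a b f = sumLen 0 (countℤ a b) (λ k → f (a ℤ.+ + k))

-- Write the left-hand summand for j = i + 1 as
--   (-1)^i q^T(n-1-i) (q;q)_i [n+i+1, 2i+2]_q,   T(m) = m(m-1)/2,
-- and let S(n) be the left-hand side and V(n) the same sum with [n+i, 2i+1]_q.
-- Both S(m+1) - q^m S(m) - q^(2m) V(m) and q^(m+1) S(m+1) - q^(2m+1) S(m) - V(m+2)
-- telescope termwise (Pascal's rule twice) against a single certificate, giving
--   D(m) = q^(2m) V(m) + q^T(m+1)   and   V(m+2) = q^(m+1) D(m) + q^T(m+2)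
-- for D(m) = S(m+1) - q^m S(m).  Hence D(m) = q^T(m+1) c(m+1) with
-- c(L) = Σ_{a+b=L, a≥1} q^(ab), and S(n) = q^T(n) (c(1) + ... + c(n)).
-- On the right, since j² - i² = (j - i)(j + i) and j² + j - i² - i = (j - i)(j + i + 1),
-- the j-th rows of the two double sums are c(2j) and c(2j+1).
module Submission where

open import Level using (Level)
open import Algebra.Bundles using (CommutativeRing; RawRing)
import Algebra.Solver.Ring.AlmostCommutativeRing as ACR
open import Data.Integer using (ℤ; +_; -[1+_])
import Data.Integer as ℤ
import Data.Integer.Properties as ℤ
open import Data.Integer.Tactic.RingSolver using () renaming (solve-∀ to ℤ-solve-∀)
open import Data.Maybe using (Maybe; just; nothing)
open import Data.Nat using (ℕ; zero; suc; _∸_; _≤_; _<_; z≤n; s≤s; _/_)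
import Data.Nat as ℕ
import Data.Nat.Properties as ℕ
open import Data.Nat.Combinatorics using (_C_; nCk+nC[k+1]≡[n+1]C[k+1]; nC1≡n)
open import Data.Nat.DivMod using (_%_; /-congˡ; m*n/n≡m; m*n%n≡0; +-distrib-/)
open import Data.Nat.Tactic.RingSolver using (solve-∀)
open import Data.Product using (∃; _,_)
open import Data.Sum using (_⊎_; inj₁; inj₂)
open import Relation.Binary.PropositionalEquality as ≡ using (_≡_)
open import Relation.Nullary using (yes; no)

open import Defs

-- The reflective ring solver takes its coefficients from the carrier, where
-- without decidable equality it cannot cancel x - x; so we instantiate
-- Algebra.Solver.Ring with integer coefficients instead.
module IntegerCoefficientRingSolver {c ℓ : Level} (R : CommutativeRing c ℓ) where
  open CommutativeRing R
  open import Algebra.Properties.Ring ring using (-0#≈0#; -‿involutive; -‿distribˡ-*; -‿+-comm)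
  open import Algebra.Properties.Semiring.Mult.TCOptimised semiring using (_×_; 1+×; ×-homo-+; ×1-homo-*)
  open import Algebra.Properties.CommutativeSemigroup *-commutativeSemigroup using (interchange)
  open import Relation.Binary.Reasoning.Setoid setoid
  open import Data.Sign as Sign using (Sign)

  private

    ⟦_⟧ : ℤ → Carrier
    ⟦ + n ⟧ = n × 1#
    ⟦ -[1+ n ] ⟧ = - (suc n × 1#)

    ⟦⊖⟧ : ∀ m n → ⟦ m ℤ.⊖ n ⟧ ≈ m × 1# - n × 1#
    ⟦⊖⟧ zero zero = sym (-‿inverseʳ 0#)
    ⟦⊖⟧ zero (suc n) = sym (+-identityˡ _)
    ⟦⊖⟧ (suc m) zero = sym (trans (+-congˡ -0#≈0#) (+-identityʳ _))
    ⟦⊖⟧ (suc m) (suc n) = begin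
      ⟦ suc m ℤ.⊖ suc n ⟧          ≡⟨ ≡.cong ⟦_⟧ (ℤ.[1+m]⊖[1+n]≡m⊖n m n) ⟩
      ⟦ m ℤ.⊖ n ⟧                  ≈⟨ ⟦⊖⟧ m n ⟩
      a - b                        ≈⟨ +-congʳ (sym (+-identityˡ a)) ⟩
      (0# + a) - b                 ≈⟨ +-congʳ (+-congʳ (sym (-‿inverseʳ 1#))) ⟩
      ((1# - 1#) + a) - b          ≈⟨ +-congʳ (trans (+-assoc _ _ _) (trans (+-congˡ (+-comm _ _)) (sym (+-assoc _ _ _)))) ⟩
      ((1# + a) - 1#) - b          ≈⟨ trans (+-assoc _ _ _) (+-congˡ (-‿+-comm 1# b)) ⟩
      (1# + a) - (1# + b)          ≈⟨ sym (+-cong (1+× m 1#) (-‿cong (1+× n 1#))) ⟩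
      suc m × 1# - suc n × 1#      ∎
      where a = m × 1#; b = n × 1#

    +-homo : ∀ i j → ⟦ i ℤ.+ j ⟧ ≈ ⟦ i ⟧ + ⟦ j ⟧
    +-homo -[1+ m ] -[1+ n ] = begin
      - (suc (suc (m ℕ.+ n)) × 1#) ≡⟨ ≡.cong (λ k → - (k × 1#)) (≡.sym (ℕ.+-suc (suc m) n)) ⟩
      - ((suc m ℕ.+ suc n) × 1#)   ≈⟨ -‿cong (×-homo-+ 1# (suc m) (suc n)) ⟩
      - (suc m × 1# + suc n × 1#)  ≈⟨ sym (-‿+-comm _ _) ⟩
      ⟦ -[1+ m ] ⟧ + ⟦ -[1+ n ] ⟧  ∎
    +-homo -[1+ m ] (+ n) = trans (⟦⊖⟧ n (suc m)) (+-comm _ _)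
    +-homo (+ m) -[1+ n ] = ⟦⊖⟧ m (suc n)
    +-homo (+ m) (+ n) = ×-homo-+ 1# m n

    ⟦_⟧± : Sign → Carrier
    ⟦ Sign.+ ⟧± = 1#
    ⟦ Sign.- ⟧± = - 1#

    ⟦⟧±-homo : ∀ s t → ⟦ s Sign.* t ⟧± ≈ ⟦ s ⟧± * ⟦ t ⟧±
    ⟦⟧±-homo Sign.+ t = sym (*-identityˡ _)
    ⟦⟧±-homo Sign.- Sign.+ = sym (*-identityʳ _)
    ⟦⟧±-homo Sign.- Sign.- = sym (trans (sym (-‿distribˡ-* _ _)) (trans (-‿cong (*-identityˡ _)) (-‿involutive _)))

    ⟦◃⟧ : ∀ s n → ⟦ s ℤ.◃ n ⟧ ≈ ⟦ s ⟧± * (n × 1#)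
    ⟦◃⟧ s zero = sym (zeroʳ _)
    ⟦◃⟧ Sign.+ (suc n) = sym (*-identityˡ _)
    ⟦◃⟧ Sign.- (suc n) = trans (-‿cong (sym (*-identityˡ _))) (-‿distribˡ-* _ _)

    ⟦⟧≈sign*abs : ∀ i → ⟦ i ⟧ ≈ ⟦ ℤ.sign i ⟧± * (ℤ.∣ i ∣ × 1#)
    ⟦⟧≈sign*abs i =
      trans (reflexive (≡.cong ⟦_⟧ (≡.sym (ℤ.◃-inverse i)))) (⟦◃⟧ (ℤ.sign i) ℤ.∣ i ∣)

    *-homo : ∀ i j → ⟦ i ℤ.* j ⟧ ≈ ⟦ i ⟧ * ⟦ j ⟧
    *-homo i j = begin
      ⟦ (s Sign.* t) ℤ.◃ (a ℕ.* b) ⟧          ≈⟨ ⟦◃⟧ (s Sign.* t) (a ℕ.* b) ⟩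
      ⟦ s Sign.* t ⟧± * ((a ℕ.* b) × 1#)      ≈⟨ *-cong (⟦⟧±-homo s t) (×1-homo-* a b) ⟩
      (⟦ s ⟧± * ⟦ t ⟧±) * ((a × 1#) * (b × 1#)) ≈⟨ interchange _ _ _ _ ⟩
      (⟦ s ⟧± * (a × 1#)) * (⟦ t ⟧± * (b × 1#)) ≈⟨ sym (*-cong (⟦⟧≈sign*abs i) (⟦⟧≈sign*abs j)) ⟩
      ⟦ i ⟧ * ⟦ j ⟧                            ∎
      where s = ℤ.sign i; t = ℤ.sign j; a = ℤ.∣ i ∣; b = ℤ.∣ j ∣

    -‿homo : ∀ i → ⟦ ℤ.- i ⟧ ≈ - ⟦ i ⟧
    -‿homo (+ zero) = sym -0#≈0#
    -‿homo (+ suc n) = refl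
    -‿homo -[1+ n ] = sym (-‿involutive _)

    ℤ-rawRing : RawRing _ _
    ℤ-rawRing = record
      { Carrier = ℤ ; _≈_ = _≡_ ; _+_ = ℤ._+_ ; _*_ = ℤ._*_ ; -_ = ℤ.-_ ; 0# = + 0 ; 1# = + 1 }

    ℤ⟶R : ℤ-rawRing ACR.-Raw-AlmostCommutative⟶ ACR.fromCommutativeRing R
    ℤ⟶R = record
      { ⟦_⟧ = ⟦_⟧ ; +-homo = +-homo ; *-homo = *-homo ; -‿homo = -‿homo
      ; 0-homo = refl ; 1-homo = refl }

    ⟦⟧-equal? : ∀ i j → Maybe (⟦ i ⟧ ≈ ⟦ j ⟧)
    ⟦⟧-equal? i j with i ℤ.≟ j
    ... | yes ≡.refl = just refl
    ... | no _ = nothing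

  open import Algebra.Solver.Ring ℤ-rawRing (ACR.fromCommutativeRing R) ℤ⟶R ⟦⟧-equal? public
    using (solve; _:=_; _:+_; _:*_; :-_; _:-_; con; Polynomial)

  𝟘 𝟙 : ∀ {n} → Polynomial n
  𝟘 = con (+ 0)
  𝟙 = con (+ 1)

triangular : ℕ → ℕ
triangular zero = 0
triangular (suc n) = triangular n ℕ.+ n

nC2≡triangular : ∀ n → n C 2 ≡ triangular n
nC2≡triangular zero = ≡.refl
nC2≡triangular (suc n) = begin
  suc n C 2                ≡⟨ ≡.sym (nCk+nC[k+1]≡[n+1]C[k+1] n 1) ⟩
  n C 1 ℕ.+ n C 2          ≡⟨ ≡.cong₂ ℕ._+_ (nC1≡n n) (nC2≡triangular n) ⟩
  n ℕ.+ triangular n       ≡⟨ ℕ.+-comm n (triangular n) ⟩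
  triangular (suc n)       ∎
  where open ≡.≡-Reasoning

even-or-odd : ∀ n → ∃ λ m → n ≡ m ℕ.+ m ⊎ n ≡ suc (m ℕ.+ m)
even-or-odd zero = 0 , inj₁ ≡.refl
even-or-odd (suc n) with even-or-odd n
... | m , inj₁ n≡m+m = m , inj₂ (≡.cong suc n≡m+m)
... | m , inj₂ n≡1+m+m = suc m , inj₁ (≡.trans (≡.cong suc n≡1+m+m) (≡.sym (≡.cong suc (ℕ.+-suc m m))))

m+m≡m*2 : ∀ m → m ℕ.+ m ≡ m ℕ.* 2
m+m≡m*2 = solve-∀

[m+m]/2≡m : ∀ m → (m ℕ.+ m) / 2 ≡ m
[m+m]/2≡m m = ≡.trans (/-congˡ {o = 2} (m+m≡m*2 m)) (m*n/n≡m m 2)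

[1+m+m]/2≡m : ∀ m → suc (m ℕ.+ m) / 2 ≡ m
[1+m+m]/2≡m m = ≡.trans (/-congˡ {o = 2} (≡.cong suc (m+m≡m*2 m)))
  (≡.trans (+-distrib-/ 1 (m ℕ.* 2) remainders<2) (m*n/n≡m m 2))
  where
  remainders<2 : 1 % 2 ℕ.+ (m ℕ.* 2) % 2 < 2
  remainders<2 = ≡.subst (λ r → 1 ℕ.+ r < 2) (≡.sym (m*n%n≡0 m 2)) (s≤s (s≤s z≤n))

∣[m-n]*[1+k]∣≡[1+k]*[m∸n] : ∀ {m n} k → n ≤ m → ℤ.∣ (+ m ℤ.- + n) ℤ.* + suc k ∣ ≡ suc k ℕ.* (m ∸ n)
∣[m-n]*[1+k]∣≡[1+k]*[m∸n] {m} {n} k n≤m = begin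
  ℤ.∣ (+ m ℤ.- + n) ℤ.* + suc k ∣   ≡⟨ ≡.cong (λ z → ℤ.∣ z ℤ.* + suc k ∣) m-n≡+[m∸n] ⟩
  ℤ.∣ + (m ∸ n) ℤ.* + suc k ∣       ≡⟨ ℤ.abs-* (+ (m ∸ n)) (+ suc k) ⟩
  (m ∸ n) ℕ.* suc k                 ≡⟨ ℕ.*-comm (m ∸ n) (suc k) ⟩
  suc k ℕ.* (m ∸ n)                 ∎
  where
  open ≡.≡-Reasoning
  m-n≡+[m∸n] : + m ℤ.- + n ≡ + (m ∸ n)
  m-n≡+[m∸n] = ≡.trans (ℤ.m-n≡m⊖n m n) (ℤ.⊖-≥ n≤m)

evenRow-exponent : ∀ j k → suc k ≤ j ℕ.+ j →
  ℤ.∣ + j ℤ.* + j ℤ.- (ℤ.1ℤ ℤ.- + j ℤ.+ + k) ℤ.* (ℤ.1ℤ ℤ.- + j ℤ.+ + k) ∣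
    ≡ suc k ℕ.* (j ℕ.+ j ∸ suc k)
evenRow-exponent j k k<j+j =
  ≡.trans (≡.cong ℤ.∣_∣ (factorise (+ j) (+ k))) (∣[m-n]*[1+k]∣≡[1+k]*[m∸n] k k<j+j)
  where
  factorise : ∀ (j k : ℤ) → j ℤ.* j ℤ.- (ℤ.1ℤ ℤ.- j ℤ.+ k) ℤ.* (ℤ.1ℤ ℤ.- j ℤ.+ k)
                              ≡ (j ℤ.+ j ℤ.- (ℤ.1ℤ ℤ.+ k)) ℤ.* (ℤ.1ℤ ℤ.+ k)
  factorise = ℤ-solve-∀

oddRow-exponent : ∀ j k → k ≤ j ℕ.+ j →
  ℤ.∣ + j ℤ.* + j ℤ.+ + j ℤ.- (ℤ.- + j ℤ.+ + k) ℤ.* (ℤ.- + j ℤ.+ + k) ℤ.- (ℤ.- + j ℤ.+ + k) ∣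
    ≡ suc k ℕ.* (suc (j ℕ.+ j) ∸ suc k)
oddRow-exponent j k k≤j+j =
  ≡.trans (≡.cong ℤ.∣_∣ (factorise (+ j) (+ k))) (∣[m-n]*[1+k]∣≡[1+k]*[m∸n] k k≤j+j)
  where
  factorise : ∀ (j k : ℤ) → j ℤ.* j ℤ.+ j ℤ.- (ℤ.- j ℤ.+ k) ℤ.* (ℤ.- j ℤ.+ k) ℤ.- (ℤ.- j ℤ.+ k)
                              ≡ (j ℤ.+ j ℤ.- k) ℤ.* (ℤ.1ℤ ℤ.+ k)
  factorise = ℤ-solve-∀


module _ {c ℓ : Level} (R : CommutativeRing c ℓ) where
  open CommutativeRing R
  open IntegerCoefficientRingSolver R
  open import Algebra.Properties.Ring ring using (x∙y⁻¹≈ε⇒x≈y; x≈y⇒x∙y⁻¹≈ε)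
  open import Relation.Binary.Reasoning.Setoid setoid

  private
    infixr 8 _^_
    _^_ : Carrier → ℕ → Carrier
    _^_ = pow R

    Σ Π : ℕ → ℕ → (ℕ → Carrier) → Carrier
    Σ = sumLen R
    Π = prodLen R

  ^-homo-* : ∀ x a b → x ^ (a ℕ.+ b) ≈ x ^ a * x ^ b
  ^-homo-* x zero b = sym (*-identityˡ _)
  ^-homo-* x (suc a) b = trans (*-congˡ (^-homo-* x a b)) (sym (*-assoc _ _ _))

  ^-congʳ : ∀ x {a b} → a ≡ b → x ^ a ≈ x ^ b
  ^-congʳ x e = reflexive (≡.cong (x ^_) e)

  ^-split : ∀ x {a} b c → a ≡ b ℕ.+ c → x ^ a ≈ x ^ b * x ^ c
  ^-split x b c e = trans (^-congʳ x e) (^-homo-* x b c)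

  -- The solver cannot use hypotheses, so identities that need a ≈ b are proved
  -- by letting it check x - y ≈ c * (a - b) with a and b as independent atoms.
  ≈-by-combination : ∀ {x y a b c} → x - y ≈ c * (a - b) → a ≈ b → x ≈ y
  ≈-by-combination {c = c} eq a≈b =
    x∙y⁻¹≈ε⇒x≈y _ _ (trans eq (trans (*-congˡ (x≈y⇒x∙y⁻¹≈ε a≈b)) (zeroʳ c)))

  ≈-by-combination₂ : ∀ {x y a b c a′ b′ c′} → x - y ≈ c * (a - b) + c′ * (a′ - b′) →
                      a ≈ b → a′ ≈ b′ → x ≈ y
  ≈-by-combination₂ {c = c} {c′ = c′} eq a≈b a′≈b′ = x∙y⁻¹≈ε⇒x≈y _ _ (begin
    _                    ≈⟨ eq ⟩
    c * _ + c′ * _       ≈⟨ +-cong (*-congˡ (x≈y⇒x∙y⁻¹≈ε a≈b))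
                                   (*-congˡ (x≈y⇒x∙y⁻¹≈ε a′≈b′)) ⟩
    c * 0# + c′ * 0#     ≈⟨ +-cong (zeroʳ c) (zeroʳ c′) ⟩
    0# + 0#              ≈⟨ +-identityˡ 0# ⟩
    0#                   ∎)

  ≈0⇒*≈0 : ∀ {x} y → x ≈ 0# → y * x ≈ 0#
  ≈0⇒*≈0 y x≈0 = trans (*-congˡ x≈0) (zeroʳ y)

  rescale : ∀ {A t T v} s Q X → A * t ≈ T * v → A * (s * t * Q * X) ≈ s * T * Q * (v * X)
  rescale s Q X At≈Tv = ≈-by-combination (identity _ s _ Q X _ _) At≈Tv
    where
    identity : ∀ A s t Q X T v → A * (s * t * Q * X) - s * T * Q * (v * X) ≈ (s * Q * X) * (A * t - T * v)
    identity = solve 7 (λ A s t Q X T v →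
      A :* (s :* t :* Q :* X) :- s :* T :* Q :* (v :* X) := (s :* Q :* X) :* (A :* t :- T :* v)) refl

  Σ-cong : ∀ s n {f g} → (∀ i → i < n → f (s ℕ.+ i) ≈ g (s ℕ.+ i)) → Σ s n f ≈ Σ s n g
  Σ-cong s zero eq = refl
  Σ-cong s (suc n) {f} {g} eq = +-cong head (Σ-cong (suc s) n tail)
    where
    head : f s ≈ g s
    head = ≡.subst (λ k → f k ≈ g k) (ℕ.+-identityʳ s) (eq 0 (s≤s z≤n))
    tail : ∀ i → i < n → f (suc s ℕ.+ i) ≈ g (suc s ℕ.+ i)
    tail i i<n = ≡.subst (λ k → f k ≈ g k) (ℕ.+-suc s i) (eq (suc i) (s≤s i<n))

  Σ-shift : ∀ s n f → Σ (suc s) n f ≡ Σ s n (λ k → f (suc k))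
  Σ-shift s zero f = ≡.refl
  Σ-shift s (suc n) f = ≡.cong (_+_ (f (suc s))) (Σ-shift (suc s) n f)

  Σ-snoc : ∀ s n f → Σ s (suc n) f ≈ Σ s n f + f (s ℕ.+ n)
  Σ-snoc s zero f = trans (+-identityʳ _) (trans (reflexive (≡.cong f (≡.sym (ℕ.+-identityʳ s)))) (sym (+-identityˡ _)))
  Σ-snoc s (suc n) f = begin
    f s + Σ (suc s) (suc n) f                   ≈⟨ +-congˡ (Σ-snoc (suc s) n f) ⟩
    f s + (Σ (suc s) n f + f (suc s ℕ.+ n))     ≈⟨ sym (+-assoc _ _ _) ⟩
    (f s + Σ (suc s) n f) + f (suc s ℕ.+ n)     ≈⟨ +-congˡ (reflexive (≡.cong f (≡.sym (ℕ.+-suc s n)))) ⟩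
    (f s + Σ (suc s) n f) + f (s ℕ.+ suc n)     ∎

  Σ-trailing-zeros : ∀ n f → (∀ i → n ≤ i → f i ≈ 0#) → ∀ k → Σ 0 (k ℕ.+ n) f ≈ Σ 0 n f
  Σ-trailing-zeros n f zeros zero = refl
  Σ-trailing-zeros n f zeros (suc k) = begin
    Σ 0 (suc k ℕ.+ n) f             ≈⟨ Σ-snoc 0 (k ℕ.+ n) f ⟩
    Σ 0 (k ℕ.+ n) f + f (k ℕ.+ n)   ≈⟨ +-cong (Σ-trailing-zeros n f zeros k) (zeros (k ℕ.+ n) (ℕ.m≤n+m n k)) ⟩
    Σ 0 n f + 0#                    ≈⟨ +-identityʳ _ ⟩
    Σ 0 n f                         ∎

  *-distribˡ-Σ : ∀ s n x f → x * Σ s n f ≈ Σ s n (λ k → x * f k)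
  *-distribˡ-Σ s zero x f = zeroʳ x
  *-distribˡ-Σ s (suc n) x f = trans (distribˡ _ _ _) (+-congˡ (*-distribˡ-Σ (suc s) n x f))

  *-distribˡ-Σ-padded : ∀ n k x f → (∀ i → n ≤ i → f i ≈ 0#) → x * Σ 0 n f ≈ Σ 0 (k ℕ.+ n) (λ i → x * f i)
  *-distribˡ-Σ-padded n k x f zeros = trans (*-congˡ (sym (Σ-trailing-zeros n f zeros k))) (*-distribˡ-Σ 0 (k ℕ.+ n) x f)

  Σ-telescope₃ : ∀ n (a b d G : ℕ → Carrier) → (∀ i → i < n → a i - b i - d i ≈ G i - G (suc i)) →
                 Σ 0 n a - Σ 0 n b - Σ 0 n d ≈ G 0 - G n
  Σ-telescope₃ zero a b d G eq = solve 1 (λ g → 𝟘 :- 𝟘 :- 𝟘 := g :- g) refl (G 0)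
  Σ-telescope₃ (suc n) a b d G eq = begin
    Σ 0 (suc n) a - Σ 0 (suc n) b - Σ 0 (suc n) d
      ≈⟨ +-cong (+-cong (Σ-snoc 0 n a) (-‿cong (Σ-snoc 0 n b))) (-‿cong (Σ-snoc 0 n d)) ⟩
    (Σ 0 n a + a n) - (Σ 0 n b + b n) - (Σ 0 n d + d n)
      ≈⟨ regroup _ _ _ _ _ _ ⟩
    (Σ 0 n a - Σ 0 n b - Σ 0 n d) + (a n - b n - d n)
      ≈⟨ +-cong (Σ-telescope₃ n a b d G (λ i i<n → eq i (ℕ.m<n⇒m<1+n i<n))) (eq n ℕ.≤-refl) ⟩
    (G 0 - G n) + (G n - G (suc n))
      ≈⟨ solve 3 (λ x y z → (x :- y) :+ (y :- z) := x :- z) refl _ _ _ ⟩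
    G 0 - G (suc n) ∎
    where
    regroup : ∀ x y z u v w → (x + u) - (y + v) - (z + w) ≈ (x - y - z) + (u - v - w)
    regroup = solve 6 (λ x y z u v w → (x :+ u) :- (y :+ v) :- (z :+ w) := (x :- y :- z) :+ (u :- v :- w)) refl

  Π-snoc : ∀ s n f → Π s (suc n) f ≈ Π s n f * f (s ℕ.+ n)
  Π-snoc s zero f = trans (*-identityʳ _) (trans (reflexive (≡.cong f (≡.sym (ℕ.+-identityʳ s)))) (sym (*-identityˡ _)))
  Π-snoc s (suc n) f = begin
    f s * Π (suc s) (suc n) f                   ≈⟨ *-congˡ (Π-snoc (suc s) n f) ⟩
    f s * (Π (suc s) n f * f (suc s ℕ.+ n))     ≈⟨ sym (*-assoc _ _ _) ⟩
    (f s * Π (suc s) n f) * f (suc s ℕ.+ n)     ≈⟨ *-congˡ (reflexive (≡.cong f (≡.sym (ℕ.+-suc s n)))) ⟩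
    (f s * Π (suc s) n f) * f (s ℕ.+ suc n)     ∎

  countℤ≡ : ∀ a b {k} → (b ℤ.+ ℤ.1ℤ) ℤ.- a ≡ + k → countℤ R a b ≡ k
  countℤ≡ a b eq with (b ℤ.+ ℤ.1ℤ) ℤ.- a
  ... | + _ = ℤ.+-injective eq

  -- Gaussian binomial coefficients

  module _ (q : Carrier) where

    qFactorial : ℕ → Carrier
    qFactorial zero = 1#
    qFactorial (suc m) = qFactorial m * (1# - q ^ suc m)

    qPoch≈qFactorial : ∀ m → qPoch R q q m ≈ qFactorial m
    qPoch≈qFactorial zero = refl
    qPoch≈qFactorial (suc m) = trans (Π-snoc 0 m _) (*-congʳ (qPoch≈qFactorial m))

    qBinomial : ℕ → ℕ → Carrier
    qBinomial n zero = 1#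
    qBinomial zero (suc k) = 0#
    qBinomial (suc n) (suc k) = qBinomial n k + q ^ suc k * qBinomial n (suc k)

    qBinomial-above : ∀ {n k} → n < k → qBinomial n k ≈ 0#
    qBinomial-above {zero} {suc k} n<k = refl
    qBinomial-above {suc n} {suc k} (s≤s n<k) = begin
      qBinomial n k + q ^ suc k * qBinomial n (suc k)  ≈⟨ +-cong (qBinomial-above n<k)
                                                                  (*-congˡ (qBinomial-above (ℕ.m<n⇒m<1+n n<k))) ⟩
      0# + q ^ suc k * 0#                              ≈⟨ trans (+-identityˡ _) (zeroʳ _) ⟩
      0#                                               ∎

    *-qBinomial-above : ∀ x {n k} → n < k → x * qBinomial n k ≈ 0#
    *-qBinomial-above x n<k = ≈0⇒*≈0 x (qBinomial-above n<k)

    qBinomial-diagonal : ∀ n → qBinomial n n ≈ 1#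
    qBinomial-diagonal zero = refl
    qBinomial-diagonal (suc n) =
      trans (+-cong (qBinomial-diagonal n) (*-qBinomial-above _ (ℕ.n<1+n n))) (+-identityʳ _)

    qBinomial-one : ∀ n → 1# - q ^ n ≈ (1# - q ^ 1) * qBinomial n 1
    qBinomial-one zero = trans (-‿inverseʳ 1#) (sym (zeroʳ _))
    qBinomial-one (suc n) = ≈-by-combination (identity q (q ^ n) (qBinomial n 1)) (qBinomial-one n)
      where
      identity : ∀ q u b → (1# - q * u) - (1# - q * 1#) * (1# + (q * 1#) * b) ≈ q * ((1# - u) - (1# - q * 1#) * b)
      identity = solve 3 (λ q u b → (𝟙 :- q :* u) :- (𝟙 :- q :* 𝟙) :* (𝟙 :+ (q :* 𝟙) :* b)
                                    := q :* ((𝟙 :- u) :- (𝟙 :- q :* 𝟙) :* b)) refl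

    qBinomial-ratio : ∀ n k → (1# - q ^ (n ∸ k)) * qBinomial n k ≈ (1# - q ^ suc k) * qBinomial n (suc k)
    qBinomial-ratio n zero = trans (*-identityʳ _) (qBinomial-one n)
    qBinomial-ratio zero (suc k) = trans (zeroʳ _) (sym (zeroʳ _))
    qBinomial-ratio (suc n) (suc k) with n ℕ.≤? k
    ... | yes n≤k = begin
      (1# - q ^ (n ∸ k)) * _  ≈⟨ *-congʳ (+-congˡ (-‿cong (^-congʳ q (ℕ.m≤n⇒m∸n≡0 n≤k)))) ⟩
      (1# - 1#) * _           ≈⟨ trans (*-congʳ (-‿inverseʳ 1#)) (zeroˡ _) ⟩
      0#                      ≈⟨ sym (*-qBinomial-above (1# - q ^ suc (suc k)) {suc n} (s≤s (s≤s n≤k))) ⟩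
      _                       ∎
    ... | no n≰k = trans (*-congʳ (+-congˡ (-‿cong q^[n∸k]≈q*a)))
                         (≈-by-combination₂ (identity q a p X Y Z) ih₁ (qBinomial-ratio n (suc k)))
      where
      k<n = ℕ.≰⇒> n≰k
      a = q ^ (n ∸ suc k)
      p = q ^ suc k
      X = qBinomial n k
      Y = qBinomial n (suc k)
      Z = qBinomial n (suc (suc k))
      q^[n∸k]≈q*a : q ^ (n ∸ k) ≈ q * a
      q^[n∸k]≈q*a = ^-congʳ q (ℕ.+-∸-assoc 1 k<n)
      ih₁ : (1# - q * a) * X ≈ (1# - p) * Y
      ih₁ = trans (*-congʳ (+-congˡ (-‿cong (sym q^[n∸k]≈q*a)))) (qBinomial-ratio n k)
      identity : ∀ q a p X Y Z →
        (1# - q * a) * (X + p * Y) - (1# - q * p) * (Y + (q * p) * Z)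
          ≈ 1# * ((1# - q * a) * X - (1# - p) * Y) + (q * p) * ((1# - a) * Y - (1# - q * p) * Z)
      identity = solve 6 (λ q a p X Y Z →
        (𝟙 :- q :* a) :* (X :+ p :* Y) :- (𝟙 :- q :* p) :* (Y :+ (q :* p) :* Z)
          := 𝟙 :* ((𝟙 :- q :* a) :* X :- (𝟙 :- p) :* Y) :+ (q :* p) :* ((𝟙 :- a) :* Y :- (𝟙 :- q :* p) :* Z)) refl

    qBinomial-pascal′ : ∀ n k → qBinomial (suc n) (suc k) ≈ q ^ (n ∸ k) * qBinomial n k + qBinomial n (suc k)
    qBinomial-pascal′ n k = ≈-by-combination (identity (q ^ (n ∸ k)) (q ^ suc k) _ _) (qBinomial-ratio n k)
      where
      identity : ∀ t p X Y → (X + p * Y) - (t * X + Y) ≈ 1# * ((1# - t) * X - (1# - p) * Y)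
      identity = solve 4 (λ t p X Y → (X :+ p :* Y) :- (t :* X :+ Y) := 𝟙 :* ((𝟙 :- t) :* X :- (𝟙 :- p) :* Y)) refl

    qBinomial-pascal′-+ : ∀ {n k} r → n ≡ k ℕ.+ r →
                          qBinomial (suc n) (suc k) ≈ q ^ r * qBinomial n k + qBinomial n (suc k)
    qBinomial-pascal′-+ {n} {k} r n≡k+r = trans (qBinomial-pascal′ n k)
      (+-congʳ (*-congʳ (^-congʳ q (≡.trans (≡.cong (_∸ k) n≡k+r) (ℕ.m+n∸m≡n k r)))))

    qBinomial-factorial : ∀ {n k} → k ≤ n → qBinomial n k * qFactorial k * qFactorial (n ∸ k) ≈ qFactorial n
    qBinomial-factorial {n} {zero} _ = trans (*-congʳ (*-identityˡ _)) (*-identityˡ _)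
    qBinomial-factorial {suc n} {suc k} (s≤s k≤n) with ℕ.m≤n⇒m<n∨m≡n k≤n
    ... | inj₂ ≡.refl = begin
      qBinomial (suc k) (suc k) * qFactorial (suc k) * qFactorial (k ∸ k)
        ≈⟨ *-cong (*-congʳ (qBinomial-diagonal (suc k))) (reflexive (≡.cong qFactorial (ℕ.n∸n≡0 k))) ⟩
      1# * qFactorial (suc k) * 1#
        ≈⟨ trans (*-identityʳ _) (*-identityˡ _) ⟩
      qFactorial (suc k) ∎
    ... | inj₁ k<n = begin
      (X + p * Y) * (A * (1# - p)) * qFactorial (n ∸ k)
        ≡⟨ ≡.cong (λ j → (X + p * Y) * (A * (1# - p)) * qFactorial j) n∸k≡1+d ⟩
      (X + p * Y) * (A * (1# - p)) * (B * (1# - w))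
        ≈⟨ ≈-by-combination₂ (identity X Y p w A B M) ih₁ ih₂ ⟩
      M * (1# - p * w)
        ≈⟨ *-congˡ (+-congˡ (-‿cong (sym (^-split q (suc k) (suc d) (≡.sym (≡.cong suc k+1+d≡n)))))) ⟩
      M * (1# - q ^ suc n) ∎
      where
      d = n ∸ suc k
      p = q ^ suc k
      w = q ^ suc d
      X = qBinomial n k
      Y = qBinomial n (suc k)
      A = qFactorial k
      B = qFactorial d
      M = qFactorial n
      n∸k≡1+d : n ∸ k ≡ suc d
      n∸k≡1+d = ℕ.+-∸-assoc 1 k<n
      k+1+d≡n : k ℕ.+ suc d ≡ n
      k+1+d≡n = ≡.trans (ℕ.+-suc k d) (ℕ.m+[n∸m]≡n k<n)
      ih₁ : X * A * (B * (1# - w)) ≈ M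
      ih₁ = trans (*-congˡ (reflexive (≡.cong qFactorial (≡.sym n∸k≡1+d)))) (qBinomial-factorial k≤n)
      ih₂ : Y * (A * (1# - p)) * B ≈ M
      ih₂ = qBinomial-factorial k<n
      identity : ∀ X Y p w A B M →
        (X + p * Y) * (A * (1# - p)) * (B * (1# - w)) - M * (1# - p * w)
          ≈ (1# - p) * (X * A * (B * (1# - w)) - M) + (p * (1# - w)) * (Y * (A * (1# - p)) * B - M)
      identity = solve 7 (λ X Y p w A B M →
        (X :+ p :* Y) :* (A :* (𝟙 :- p)) :* (B :* (𝟙 :- w)) :- M :* (𝟙 :- p :* w)
          := (𝟙 :- p) :* (X :* A :* (B :* (𝟙 :- w)) :- M) :+ (p :* (𝟙 :- w)) :* (Y :* (A :* (𝟙 :- p)) :* B :- M)) refl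

    -- The telescoping recurrences

    sign : ℕ → Carrier
    sign i = (- 1#) ^ i

    -- The left-hand summand for j = i + 1, with (q;q)_{n+j} / ((q;q)_{n-j} (q;q)_{2j})
    -- written as a Gaussian binomial; evenSum and oddSum are S and V above.
    evenTerm : ℕ → ℕ → Carrier
    evenTerm n i = sign i * q ^ triangular (n ∸ suc i) * qFactorial i * qBinomial (suc i ℕ.+ n) (suc i ℕ.+ suc i)

    oddTerm : ℕ → ℕ → Carrier
    oddTerm n i = sign i * q ^ triangular (n ∸ suc i) * qFactorial i * qBinomial (i ℕ.+ n) (i ℕ.+ suc i)

    evenSum oddSum : ℕ → Carrier
    evenSum n = Σ 0 n (evenTerm n)
    oddSum n = Σ 0 n (oddTerm n)

    certificate : ℕ → ℕ → Carrier
    certificate n i = sign i * q ^ triangular (suc n ∸ i) * qFactorial i * qBinomial (i ℕ.+ n) (i ℕ.+ i)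

    evenTerm-vanishes : ∀ {n i} → n ≤ i → evenTerm n i ≈ 0#
    evenTerm-vanishes {n} {i} n≤i = *-qBinomial-above _ (ℕ.+-monoʳ-< (suc i) (s≤s n≤i))

    oddTerm-vanishes : ∀ {n i} → n ≤ i → oddTerm n i ≈ 0#
    oddTerm-vanishes {n} {i} n≤i = *-qBinomial-above _ (ℕ.+-monoʳ-< i (s≤s n≤i))

    certificate-vanishes : ∀ {n i} → n < i → certificate n i ≈ 0#
    certificate-vanishes {n} {i} n<i = *-qBinomial-above _ (ℕ.+-monoʳ-< i n<i)

    certificate-start : ∀ n → certificate n 0 ≈ q ^ triangular (suc n)
    certificate-start n = trans (*-identityʳ _) (trans (*-identityʳ _) (*-identityˡ _))

    q^triangular-∸ : ∀ {m} i r → m ≡ i ℕ.+ r → q ^ triangular (m ∸ i) ≈ q ^ triangular r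
    q^triangular-∸ i r ≡.refl = ^-congʳ q (≡.cong triangular (ℕ.m+n∸m≡n i r))

    q^triangular-suc-∸ : ∀ {m} i r → m ≡ i ℕ.+ r → q ^ triangular (suc m ∸ i) ≈ q ^ triangular r * q ^ r
    q^triangular-suc-∸ i r m≡i+r =
      trans (q^triangular-∸ i (suc r) (≡.trans (≡.cong suc m≡i+r) (≡.sym (ℕ.+-suc i r)))) (^-homo-* q (triangular r) r)

    q^m*evenTerm : ∀ i r → q ^ (i ℕ.+ r) * evenTerm (i ℕ.+ r) i ≈
      sign i * q ^ triangular r * qFactorial i * (q ^ suc i * qBinomial (suc (i ℕ.+ (i ℕ.+ r))) (suc (i ℕ.+ suc i)))
    q^m*evenTerm i zero = trans (≈0⇒*≈0 _ (evenTerm-vanishes i+0≤i))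
                                (sym (≈0⇒*≈0 _ (*-qBinomial-above _ (s≤s (ℕ.+-monoʳ-< i (s≤s i+0≤i))))))
      where i+0≤i = ℕ.≤-reflexive (ℕ.+-identityʳ i)
    q^m*evenTerm i (suc r) = begin
      q ^ m * (sign i * q ^ triangular (m ∸ suc i) * qFactorial i * X)
        ≈⟨ *-congˡ (*-congʳ (*-congʳ (*-congˡ (q^triangular-∸ (suc i) r (ℕ.+-suc i r))))) ⟩
      q ^ m * (sign i * q ^ triangular r * qFactorial i * X)
        ≈⟨ rescale (sign i) (qFactorial i) X powers ⟩
      sign i * q ^ triangular (suc r) * qFactorial i * (q ^ suc i * X) ∎
      where
      m = i ℕ.+ suc r
      X = qBinomial (suc (i ℕ.+ m)) (suc (i ℕ.+ suc i))
      exponents : ∀ i r t → (i ℕ.+ suc r) ℕ.+ t ≡ (t ℕ.+ r) ℕ.+ suc i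
      exponents = solve-∀
      powers : q ^ m * q ^ triangular r ≈ q ^ triangular (suc r) * q ^ suc i
      powers = trans (sym (^-homo-* q m (triangular r))) (^-split q _ (suc i) (exponents i r (triangular r)))

    q^[m+m]*oddTerm : ∀ i r → let m = i ℕ.+ r in q ^ (m ℕ.+ m) * oddTerm m i ≈
      sign i * q ^ triangular r * qFactorial i * (q ^ suc (i ℕ.+ m) * qBinomial (i ℕ.+ m) (suc (i ℕ.+ i)))
    q^[m+m]*oddTerm i zero = trans (≈0⇒*≈0 _ (oddTerm-vanishes (ℕ.≤-reflexive (ℕ.+-identityʳ i))))
                                   (sym (≈0⇒*≈0 _ (*-qBinomial-above _ (s≤s (ℕ.≤-reflexive i+[i+0]≡i+i)))))
      where i+[i+0]≡i+i = ≡.cong (i ℕ.+_) (ℕ.+-identityʳ i)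
    q^[m+m]*oddTerm i (suc r) = begin
      q ^ (m ℕ.+ m) * (sign i * q ^ triangular (m ∸ suc i) * qFactorial i * qBinomial (i ℕ.+ m) (i ℕ.+ suc i))
        ≈⟨ *-congˡ (*-cong (*-congʳ (*-congˡ (q^triangular-∸ (suc i) r (ℕ.+-suc i r))))
                           (reflexive (≡.cong (qBinomial (i ℕ.+ m)) (ℕ.+-suc i i)))) ⟩
      q ^ (m ℕ.+ m) * (sign i * q ^ triangular r * qFactorial i * X)
        ≈⟨ rescale (sign i) (qFactorial i) X powers ⟩
      sign i * q ^ triangular (suc r) * qFactorial i * (q ^ suc (i ℕ.+ m) * X) ∎
      where
      m = i ℕ.+ suc r
      X = qBinomial (i ℕ.+ m) (suc (i ℕ.+ i))
      exponents : ∀ i r t → ((i ℕ.+ suc r) ℕ.+ (i ℕ.+ suc r)) ℕ.+ t ≡ (t ℕ.+ r) ℕ.+ suc (i ℕ.+ (i ℕ.+ suc r))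
      exponents = solve-∀
      powers : q ^ (m ℕ.+ m) * q ^ triangular r ≈ q ^ triangular (suc r) * q ^ suc (i ℕ.+ m)
      powers = trans (sym (^-homo-* q (m ℕ.+ m) (triangular r)))
                     (^-split q (triangular (suc r)) (suc (i ℕ.+ m)) (exponents i r (triangular r)))

    evenTerm-step : ∀ i r {m} → m ≡ i ℕ.+ r →
      evenTerm (suc m) i - q ^ m * evenTerm m i - q ^ (m ℕ.+ m) * oddTerm m i ≈ certificate m i - certificate m (suc i)
    evenTerm-step i r ≡.refl = begin
      evenTerm (suc m) i - q ^ m * evenTerm m i - q ^ (m ℕ.+ m) * oddTerm m i
        ≈⟨ +-cong (+-cong (*-congʳ (*-congʳ (*-congˡ T[m∸i])))
                          (-‿cong (q^m*evenTerm i r)))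
                  (-‿cong (trans (q^[m+m]*oddTerm i r) (*-congˡ (*-congʳ q^[1+i+m])))) ⟩
      s * T * Q * B - s * T * Q * (q * u * C₀) - s * T * Q * (q * (u * (u * y)) * D₁)
        ≈⟨ ≈-by-combination₂ (identity s T Q u y q C₀ C₁ D₁ D₂ B) pascal-B pascal-C₁ ⟩
      s * (T * y) * Q * D₂ - (- 1# * s) * T * (Q * (1# - q * u)) * C₀
        ≈⟨ +-cong (*-congʳ (*-congʳ (*-congˡ (sym T[1+m∸i]))))
                  (-‿cong (*-congʳ (*-congʳ (*-congˡ (sym T[m∸i]))))) ⟩
      certificate m i - certificate m (suc i) ∎
      where
      m = i ℕ.+ r
      s = sign i
      T = q ^ triangular r
      Q = qFactorial i
      u = q ^ i
      y = q ^ r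
      B = qBinomial (suc (i ℕ.+ suc m)) (suc (i ℕ.+ suc i))
      C₀ = qBinomial (suc (i ℕ.+ m)) (suc (i ℕ.+ suc i))
      C₁ = qBinomial (i ℕ.+ suc m) (i ℕ.+ suc i)
      D₁ = qBinomial (i ℕ.+ m) (suc (i ℕ.+ i))
      D₂ = qBinomial (i ℕ.+ m) (i ℕ.+ i)
      T[m∸i] : q ^ triangular (m ∸ i) ≈ T
      T[m∸i] = q^triangular-∸ i r ≡.refl
      T[1+m∸i] : q ^ triangular (suc m ∸ i) ≈ T * y
      T[1+m∸i] = q^triangular-suc-∸ i r ≡.refl
      q^[1+i+m] : q ^ suc (i ℕ.+ m) ≈ q * (u * (u * y))
      q^[1+i+m] = *-congˡ (trans (^-homo-* q i m) (*-congˡ (^-homo-* q i r)))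
      pascal-B : B ≈ y * C₁ + C₀
      pascal-B = trans (qBinomial-pascal′-+ r (≡.sym (ℕ.+-assoc i (suc i) r)))
                       (+-congˡ (reflexive (≡.cong (λ a → qBinomial a (suc (i ℕ.+ suc i))) (ℕ.+-suc i m))))
      pascal-C₁ : C₁ ≈ D₂ + q * (u * u) * D₁
      pascal-C₁ = trans (reflexive (≡.cong₂ qBinomial (ℕ.+-suc i m) (ℕ.+-suc i i)))
                        (+-congˡ (*-congʳ (*-congˡ (^-homo-* q i i))))
      identity : ∀ s T Q u y q C₀ C₁ D₁ D₂ B →
        (s * T * Q * B - s * T * Q * (q * u * C₀) - s * T * Q * (q * (u * (u * y)) * D₁))
          - (s * (T * y) * Q * D₂ - (- 1# * s) * T * (Q * (1# - q * u)) * C₀)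
        ≈ (s * T * Q) * (B - (y * C₁ + C₀)) + (s * T * Q * y) * (C₁ - (D₂ + q * (u * u) * D₁))
      identity = solve 11 (λ s T Q u y q C₀ C₁ D₁ D₂ B →
        (s :* T :* Q :* B :- s :* T :* Q :* (q :* u :* C₀) :- s :* T :* Q :* (q :* (u :* (u :* y)) :* D₁))
          :- (s :* (T :* y) :* Q :* D₂ :- (:- 𝟙 :* s) :* T :* (Q :* (𝟙 :- q :* u)) :* C₀)
        := (s :* T :* Q) :* (B :- (y :* C₁ :+ C₀)) :+ (s :* T :* Q :* y) :* (C₁ :- (D₂ :+ q :* (u :* u) :* D₁))) refl

    oddTerm-step : ∀ i r {m} → m ≡ i ℕ.+ r → let n = suc m in
      q ^ n * evenTerm n i - q ^ (n ℕ.+ m) * evenTerm m i - oddTerm (suc n) i ≈ certificate n (suc i) - certificate n i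
    oddTerm-step i r ≡.refl = begin
      q ^ n * evenTerm n i - q ^ (n ℕ.+ m) * evenTerm m i - oddTerm (suc n) i
        ≈⟨ +-cong (+-cong (*-cong q^n (*-congʳ (*-congʳ (*-congˡ T[m∸i])))) (-‿cong q^[n+m]*evenTerm))
                  (-‿cong (*-congʳ (*-congʳ (*-congˡ T[1+m∸i])))) ⟩
      w * (s * T * Q * B) - w * (s * T * Q * (q * u * C₀)) - s * (T * y) * Q * B′
        ≈⟨ ≈-by-combination₂ (identity s T Q u y q C₀ C₁ C₂ B B′) pascal-B pascal-B′ ⟩
      (- 1# * s) * (T * y) * (Q * (1# - q * u)) * B - s * (T * y * (q * y)) * Q * C₂
        ≈⟨ +-cong (*-congʳ (*-congʳ (*-congˡ (sym T[1+m∸i]))))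
                  (-‿cong (*-congʳ (*-congʳ (*-congˡ (sym T[2+m∸i]))))) ⟩
      certificate n (suc i) - certificate n i ∎
      where
      m = i ℕ.+ r
      n = suc m
      s = sign i
      T = q ^ triangular r
      Q = qFactorial i
      u = q ^ i
      y = q ^ r
      w = q * (u * y)
      B = qBinomial (suc (i ℕ.+ suc m)) (suc (i ℕ.+ suc i))
      B′ = qBinomial (i ℕ.+ suc n) (i ℕ.+ suc i)
      C₀ = qBinomial (suc (i ℕ.+ m)) (suc (i ℕ.+ suc i))
      C₁ = qBinomial (i ℕ.+ suc m) (i ℕ.+ suc i)
      C₂ = qBinomial (i ℕ.+ suc m) (i ℕ.+ i)
      q^n : q ^ n ≈ w
      q^n = *-congˡ (^-homo-* q i r)
      T[m∸i] : q ^ triangular (m ∸ i) ≈ T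
      T[m∸i] = q^triangular-∸ i r ≡.refl
      T[1+m∸i] : q ^ triangular (n ∸ i) ≈ T * y
      T[1+m∸i] = q^triangular-suc-∸ i r ≡.refl
      T[2+m∸i] : q ^ triangular (suc n ∸ i) ≈ T * y * (q * y)
      T[2+m∸i] = trans (q^triangular-suc-∸ i (suc r) (≡.sym (ℕ.+-suc i r))) (*-congʳ (^-homo-* q (triangular r) r))
      q^[n+m]*evenTerm : q ^ (n ℕ.+ m) * evenTerm m i ≈ w * (s * T * Q * (q * u * C₀))
      q^[n+m]*evenTerm = trans (*-congʳ (^-homo-* q n m)) (trans (*-assoc _ _ _) (*-cong q^n (q^m*evenTerm i r)))
      pascal-B : B ≈ C₁ + q * (q * (u * u)) * C₀
      pascal-B = +-congˡ (*-cong (*-congˡ (trans (^-congʳ q (ℕ.+-suc i i)) (*-congˡ (^-homo-* q i i))))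
                                 (reflexive (≡.cong (λ a → qBinomial a (suc (i ℕ.+ suc i))) (ℕ.+-suc i m))))
      pascal-B′ : B′ ≈ q * y * C₂ + C₁
      pascal-B′ = trans (reflexive (≡.cong₂ qBinomial (ℕ.+-suc i n) (ℕ.+-suc i i)))
        (trans (qBinomial-pascal′-+ (suc r) (≡.trans (≡.cong (i ℕ.+_) (≡.sym (ℕ.+-suc i r))) (≡.sym (ℕ.+-assoc i i (suc r)))))
               (+-congˡ (reflexive (≡.cong (qBinomial (i ℕ.+ suc m)) (≡.sym (ℕ.+-suc i i))))))
      identity : ∀ s T Q u y q C₀ C₁ C₂ B B′ →
        (q * (u * y) * (s * T * Q * B) - q * (u * y) * (s * T * Q * (q * u * C₀)) - s * (T * y) * Q * B′)
          - ((- 1# * s) * (T * y) * (Q * (1# - q * u)) * B - s * (T * y * (q * y)) * Q * C₂)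
        ≈ (s * T * y * Q) * (B - (C₁ + q * (q * (u * u)) * C₀)) + (- (s * T * y * Q)) * (B′ - (q * y * C₂ + C₁))
      identity = solve 11 (λ s T Q u y q C₀ C₁ C₂ B B′ →
        (q :* (u :* y) :* (s :* T :* Q :* B) :- q :* (u :* y) :* (s :* T :* Q :* (q :* u :* C₀)) :- s :* (T :* y) :* Q :* B′)
          :- ((:- 𝟙 :* s) :* (T :* y) :* (Q :* (𝟙 :- q :* u)) :* B :- s :* (T :* y :* (q :* y)) :* Q :* C₂)
        := (s :* T :* y :* Q) :* (B :- (C₁ :+ q :* (q :* (u :* u)) :* C₀)) :+ (:- (s :* T :* y :* Q)) :* (B′ :- (q :* y :* C₂ :+ C₁))) refl

    oddTerm-step-last : ∀ m → let n = suc m in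
      q ^ n * evenTerm n n - q ^ (n ℕ.+ m) * evenTerm m n - oddTerm (suc n) n ≈ certificate n (suc n) - certificate n n
    oddTerm-step-last m = begin
      q ^ n * evenTerm n n - q ^ (n ℕ.+ m) * evenTerm m n - oddTerm (suc n) n
        ≈⟨ +-cong (+-cong (≈0⇒*≈0 _ (evenTerm-vanishes {n} ℕ.≤-refl))
                          (-‿cong (≈0⇒*≈0 _ (evenTerm-vanishes {m} (ℕ.n≤1+n m)))))
                  (-‿cong (trans (*-cong (*-congʳ (*-congˡ (q^triangular-∸ n 0 (≡.sym (ℕ.+-identityʳ n)))))
                                         (qBinomial-diagonal (n ℕ.+ suc n)))
                                 (*-identityʳ _))) ⟩
      0# - 0# - sign n * 1# * qFactorial n
        ≈⟨ +-congʳ (-‿inverseʳ 0#) ⟩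
      0# - sign n * 1# * qFactorial n
        ≈⟨ sym (+-cong (certificate-vanishes {n} (ℕ.n<1+n n))
                       (-‿cong (trans (*-cong (*-congʳ (*-congˡ (q^triangular-∸ n 1 (≡.sym (ℕ.+-comm n 1)))))
                                              (qBinomial-diagonal (n ℕ.+ n)))
                                      (*-identityʳ _)))) ⟩
      certificate n (suc n) - certificate n n ∎
      where n = suc m

    evenSum-recurrence : ∀ m → evenSum (suc m) - q ^ m * evenSum m ≈ q ^ (m ℕ.+ m) * oddSum m + q ^ triangular (suc m)
    evenSum-recurrence m = ≈-by-combination (identity _ _ _ _) (begin
      evenSum (suc m) - q ^ m * evenSum m - q ^ (m ℕ.+ m) * oddSum m
        ≈⟨ +-cong (+-congˡ (-‿cong (*-distribˡ-Σ-padded m 1 _ _ (λ _ → evenTerm-vanishes))))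
                  (-‿cong (*-distribˡ-Σ-padded m 1 _ _ (λ _ → oddTerm-vanishes))) ⟩
      Σ 0 (suc m) (evenTerm (suc m)) - Σ 0 (suc m) (λ i → q ^ m * evenTerm m i)
        - Σ 0 (suc m) (λ i → q ^ (m ℕ.+ m) * oddTerm m i)
        ≈⟨ Σ-telescope₃ (suc m) _ _ _ (certificate m) (λ i i<1+m → step (ℕ.≤-pred i<1+m)) ⟩
      certificate m 0 - certificate m (suc m)
        ≈⟨ +-cong (certificate-start m) (-‿cong (certificate-vanishes (ℕ.n<1+n m))) ⟩
      q ^ triangular (suc m) - 0# ∎)
      where
      step : ∀ {i} → i ≤ m → evenTerm (suc m) i - q ^ m * evenTerm m i - q ^ (m ℕ.+ m) * oddTerm m i
                              ≈ certificate m i - certificate m (suc i)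
      step {i} i≤m = evenTerm-step i (m ∸ i) (≡.sym (ℕ.m+[n∸m]≡n i≤m))
      identity : ∀ a b d t → (a - b) - (d + t) ≈ 1# * ((a - b - d) - (t - 0#))
      identity = solve 4 (λ a b d t → (a :- b) :- (d :+ t) := 𝟙 :* ((a :- b :- d) :- (t :- 𝟘))) refl

    oddSum-recurrence : ∀ m → oddSum (suc (suc m))
                              ≈ q ^ suc m * (evenSum (suc m) - q ^ m * evenSum m) + q ^ triangular (suc (suc m))
    oddSum-recurrence m = ≈-by-combination (identity _ _ _ _ _ _) (begin
      q ^ n * evenSum n - q ^ n * q ^ m * evenSum m - oddSum (suc n)
        ≈⟨ +-cong (+-cong (*-distribˡ-Σ-padded n 1 _ _ (λ _ → evenTerm-vanishes))
                          (-‿cong (trans (*-congʳ (sym (^-homo-* q n m)))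
                                         (*-distribˡ-Σ-padded m 2 _ _ (λ _ → evenTerm-vanishes)))))
                  refl ⟩
      Σ 0 (suc n) (λ i → q ^ n * evenTerm n i) - Σ 0 (suc n) (λ i → q ^ (n ℕ.+ m) * evenTerm m i)
        - Σ 0 (suc n) (oddTerm (suc n))
        ≈⟨ Σ-telescope₃ (suc n) _ _ _ (λ i → - certificate n i) (λ i i<2+m → step (ℕ.≤-pred i<2+m)) ⟩
      - certificate n 0 - - certificate n (suc n)
        ≈⟨ +-cong (-‿cong (certificate-start n)) (-‿cong (-‿cong (certificate-vanishes (ℕ.n<1+n n)))) ⟩
      - q ^ triangular (suc n) - - 0# ∎)
      where
      n = suc m
      step : ∀ {i} → i ≤ n → q ^ n * evenTerm n i - q ^ (n ℕ.+ m) * evenTerm m i - oddTerm (suc n) i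
                              ≈ - certificate n i - - certificate n (suc i)
      step {i} i≤n = trans (telescoping-term i≤n) (solve 2 (λ x y → x :- y := (:- y) :- (:- x)) refl _ _)
        where
        telescoping-term : i ≤ n → q ^ n * evenTerm n i - q ^ (n ℕ.+ m) * evenTerm m i - oddTerm (suc n) i
                                  ≈ certificate n (suc i) - certificate n i
        telescoping-term i≤n with ℕ.m≤n⇒m<n∨m≡n i≤n
        ... | inj₂ ≡.refl = oddTerm-step-last m
        ... | inj₁ (s≤s i≤m) = oddTerm-step i (m ∸ i) (≡.sym (ℕ.m+[n∸m]≡n i≤m))
      identity : ∀ p p′ e e′ o t → o - (p * (e - p′ * e′) + t) ≈ - 1# * ((p * e - p * p′ * e′ - o) - (- t - - 0#))
      identity = solve 6 (λ p p′ e e′ o t → o :- (p :* (e :- p′ :* e′) :+ t)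
                                             := :- 𝟙 :* ((p :* e :- p :* p′ :* e′ :- o) :- (:- t :- :- 𝟘))) refl

    -- c(n) above, with a = k + 1.
    splitSum : ℕ → Carrier
    splitSum n = Σ 0 n (λ k → q ^ (suc k ℕ.* (n ∸ suc k)))

    cumulativeSplitSum : ℕ → Carrier
    cumulativeSplitSum n = Σ 0 n (λ k → splitSum (suc k))

    splitSum-recurrence : ∀ n → splitSum (suc (suc n)) ≈ q ^ suc n + (q ^ suc n * splitSum n + 1#)
    splitSum-recurrence n = +-cong (^-congʳ q (ℕ.*-identityˡ (suc n))) (begin
      Σ 1 (suc n) f                        ≈⟨ Σ-snoc 1 n f ⟩
      Σ 1 n f + f (suc n)                  ≈⟨ +-cong (reflexive (Σ-shift 0 n f)) (^-congʳ q last-exponent) ⟩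
      Σ 0 n (λ k → f (suc k)) + 1#         ≈⟨ +-congʳ (Σ-cong 0 n inner) ⟩
      Σ 0 n (λ k → q ^ suc n * g k) + 1#   ≈⟨ +-congʳ (sym (*-distribˡ-Σ 0 n _ g)) ⟩
      q ^ suc n * splitSum n + 1#          ∎)
      where
      f g : ℕ → Carrier
      f k = q ^ (suc k ℕ.* (suc (suc n) ∸ suc k))
      g k = q ^ (suc k ℕ.* (n ∸ suc k))
      last-exponent : suc (suc n) ℕ.* (n ∸ n) ≡ 0
      last-exponent = ≡.trans (≡.cong (suc (suc n) ℕ.*_) (ℕ.n∸n≡0 n)) (ℕ.*-zeroʳ (suc (suc n)))
      expand : ∀ k d → suc (suc k) ℕ.* suc d ≡ suc (suc (k ℕ.+ d)) ℕ.+ suc k ℕ.* d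
      expand = solve-∀
      inner : ∀ k → k < n → f (suc k) ≈ q ^ suc n * g k
      inner k k<n = ^-split q (suc n) _ (≡.trans (≡.cong (suc (suc k) ℕ.*_) (ℕ.+-∸-assoc 1 k<n))
        (≡.trans (expand k (n ∸ suc k)) (≡.cong (λ x → suc x ℕ.+ suc k ℕ.* (n ∸ suc k)) (ℕ.m+[n∸m]≡n k<n))))

    evenSum-difference : ∀ m → evenSum (suc m) - q ^ m * evenSum m ≈ q ^ triangular (suc m) * splitSum (suc m)
    evenSum-difference zero = trans (evenSum-recurrence 0) (solve 0 (𝟙 :* 𝟘 :+ 𝟙 := 𝟙 :* (𝟙 :+ 𝟘)) refl)
    evenSum-difference (suc zero) = begin
      evenSum 2 - q ^ 1 * evenSum 1  ≈⟨ evenSum-recurrence 1 ⟩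
      q ^ 2 * oddSum 1 + q ^ 1       ≈⟨ +-congʳ (*-congˡ oddSum-one) ⟩
      q ^ 2 * 1# + q ^ 1             ≈⟨ solve 1 (λ q → q :* (q :* 𝟙) :* 𝟙 :+ q :* 𝟙
                                                   := (q :* 𝟙) :* (q :* 𝟙 :+ (𝟙 :+ 𝟘))) refl q ⟩
      q ^ 1 * splitSum 2             ∎
      where
      oddSum-one : oddSum 1 ≈ 1#
      oddSum-one = trans (+-identityʳ _) (trans (*-congˡ (qBinomial-diagonal 1))
                     (trans (*-identityʳ _) (trans (*-identityʳ _) (*-identityˡ _))))
    evenSum-difference (suc (suc m)) = begin
      evenSum (suc M) - q ^ M * evenSum M
        ≈⟨ evenSum-recurrence M ⟩
      q ^ (M ℕ.+ M) * oddSum M + q ^ triangular (suc M)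
        ≈⟨ +-congʳ (*-congˡ (oddSum-recurrence m)) ⟩
      q ^ (M ℕ.+ M) * (a * (evenSum (suc m) - q ^ m * evenSum m) + q ^ triangular M) + q ^ triangular (suc M)
        ≈⟨ +-cong (*-cong (^-homo-* q M M) (+-cong (*-congˡ (evenSum-difference m)) A*a)) A*a*[q*a] ⟩
      (q * a) * (q * a) * (a * (A * S) + A * a) + A * a * (q * a)
        ≈⟨ solve 4 (λ A a q c → (q :* a) :* (q :* a) :* (a :* (A :* c) :+ A :* a) :+ A :* a :* (q :* a)
                               := A :* a :* (q :* a) :* (q :* a :+ (q :* a :* c :+ 𝟙))) refl A a q S ⟩
      A * a * (q * a) * (q * a + (q * a * S + 1#))
        ≈⟨ sym (*-cong A*a*[q*a] (splitSum-recurrence (suc m))) ⟩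
      q ^ triangular (suc M) * splitSum (suc M) ∎
      where
      M = suc (suc m)
      A = q ^ triangular (suc m)
      a = q ^ suc m
      S = splitSum (suc m)
      A*a : q ^ triangular M ≈ A * a
      A*a = ^-homo-* q (triangular (suc m)) (suc m)
      A*a*[q*a] : q ^ triangular (suc M) ≈ A * a * (q * a)
      A*a*[q*a] = trans (^-homo-* q (triangular M) M) (*-congʳ A*a)

    evenSum-closed : ∀ n → evenSum n ≈ q ^ triangular n * cumulativeSplitSum n
    evenSum-closed zero = sym (*-identityˡ _)
    evenSum-closed (suc m) = begin
      evenSum (suc m)
        ≈⟨ solve 2 (λ x y → x := (x :- y) :+ y) refl _ _ ⟩
      (evenSum (suc m) - q ^ m * evenSum m) + q ^ m * evenSum m
        ≈⟨ +-cong (trans (evenSum-difference m) (*-congʳ (^-homo-* q (triangular m) m))) (*-congˡ (evenSum-closed m)) ⟩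
      (T * q ^ m) * splitSum (suc m) + q ^ m * (T * cumulativeSplitSum m)
        ≈⟨ solve 4 (λ T x c t → (T :* x) :* c :+ x :* (T :* t) := (T :* x) :* (t :+ c)) refl T (q ^ m) _ _ ⟩
      (T * q ^ m) * (cumulativeSplitSum m + splitSum (suc m))
        ≈⟨ sym (*-cong (^-homo-* q (triangular m) m) (Σ-snoc 0 m (λ k → splitSum (suc k)))) ⟩
      q ^ triangular (suc m) * cumulativeSplitSum (suc m) ∎
      where
      T = q ^ triangular m

    qFactorial*inverses : ∀ {N inv} → (∀ k → 1 ≤ k → k ≤ N → (1# - q ^ k) * inv k ≈ 1#) →
                          ∀ {K} → K ≤ N → qFactorial K * Π 1 K inv ≈ 1#
    qFactorial*inverses inverse {zero} _ = *-identityˡ _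
    qFactorial*inverses {inv = inv} inverse {suc K} 1+K≤N = begin
      qFactorial K * (1# - q ^ suc K) * Π 1 (suc K) inv
        ≈⟨ *-congˡ (Π-snoc 1 K inv) ⟩
      qFactorial K * (1# - q ^ suc K) * (Π 1 K inv * inv (suc K))
        ≈⟨ solve 4 (λ a b c d → a :* b :* (c :* d) := (a :* c) :* (b :* d)) refl _ _ _ _ ⟩
      (qFactorial K * Π 1 K inv) * ((1# - q ^ suc K) * inv (suc K))
        ≈⟨ *-cong (qFactorial*inverses inverse (ℕ.≤-trans (ℕ.n≤1+n K) 1+K≤N)) (inverse (suc K) (s≤s z≤n) 1+K≤N) ⟩
      1# * 1#
        ≈⟨ *-identityˡ 1# ⟩
      1# ∎

    lhsSummand : ℕ → (ℕ → Carrier) → ℕ → Carrier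
    lhsSummand n inv j = (- 1#) ^ (j ∸ 1) * q ^ ((n ∸ j) C 2)
      * qPoch R q q (n ℕ.+ j) * qPoch R q q (j ∸ 1)
      * Π 1 (n ∸ j) inv * Π 1 (2 ℕ.* j) inv

    module _ (n : ℕ) (inv : ℕ → Carrier) (inverse : ∀ k → 1 ≤ k → k ≤ 2 ℕ.* n → (1# - q ^ k) * inv k ≈ 1#) where

      qPoch-quotient : ∀ {i} → i < n → let j = suc i in
        qPoch R q q (n ℕ.+ j) * Π 1 (n ∸ j) inv * Π 1 (2 ℕ.* j) inv ≈ qBinomial (j ℕ.+ n) (j ℕ.+ j)
      qPoch-quotient {i} i<n = begin
        qPoch R q q N * Π 1 r inv * Π 1 K inv
          ≈⟨ *-congʳ (*-congʳ (trans (qPoch≈qFactorial N) (sym (qBinomial-factorial K≤N)))) ⟩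
        qBinomial N K * qFactorial K * qFactorial (N ∸ K) * Π 1 r inv * Π 1 K inv
          ≡⟨ ≡.cong (λ d → qBinomial N K * qFactorial K * qFactorial d * Π 1 r inv * Π 1 K inv) N∸K≡r ⟩
        qBinomial N K * qFactorial K * qFactorial r * Π 1 r inv * Π 1 K inv
          ≈⟨ solve 5 (λ a b c d e → a :* b :* c :* d :* e := a :* (b :* e) :* (c :* d)) refl _ _ _ _ _ ⟩
        qBinomial N K * (qFactorial K * Π 1 K inv) * (qFactorial r * Π 1 r inv)
          ≈⟨ *-cong (*-congˡ (qFactorial*inverses inverse K≤2n)) (qFactorial*inverses inverse r≤2n) ⟩
        qBinomial N K * 1# * 1#
          ≈⟨ trans (*-identityʳ _) (*-identityʳ _) ⟩
        qBinomial N K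
          ≡⟨ ≡.cong₂ qBinomial (ℕ.+-comm n j) K≡j+j ⟩
        qBinomial (j ℕ.+ n) (j ℕ.+ j) ∎
        where
        j = suc i
        r = n ∸ j
        N = n ℕ.+ j
        K = 2 ℕ.* j
        K≡j+j : K ≡ j ℕ.+ j
        K≡j+j = ≡.cong (j ℕ.+_) (ℕ.+-identityʳ j)
        K≤N : K ≤ N
        K≤N = ≡.subst (_≤ N) (≡.sym K≡j+j) (ℕ.+-monoˡ-≤ j i<n)
        N∸K≡r : N ∸ K ≡ r
        N∸K≡r = ≡.trans (≡.cong₂ _∸_ (ℕ.+-comm n j) K≡j+j) (ℕ.[m+n]∸[m+o]≡n∸o j n j)
        K≤2n : K ≤ 2 ℕ.* n
        K≤2n = ℕ.*-monoʳ-≤ 2 i<n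
        r≤2n : r ≤ 2 ℕ.* n
        r≤2n = ℕ.≤-trans (ℕ.m∸n≤m n j) (ℕ.m≤m+n n (n ℕ.+ 0))

      lhsSummand≈evenTerm : ∀ {i} → i < n → lhsSummand n inv (suc i) ≈ evenTerm n i
      lhsSummand≈evenTerm {i} i<n = begin
        s * T * P₁ * P₂ * I₁ * I₂
          ≈⟨ solve 6 (λ s T P₁ P₂ I₁ I₂ → s :* T :* P₁ :* P₂ :* I₁ :* I₂ := s :* T :* P₂ :* (P₁ :* I₁ :* I₂))
                     refl s T P₁ P₂ I₁ I₂ ⟩
        s * T * P₂ * (P₁ * I₁ * I₂)
          ≈⟨ *-cong (*-cong (*-congˡ (^-congʳ q (nC2≡triangular (n ∸ suc i)))) (qPoch≈qFactorial i))
                    (qPoch-quotient i<n) ⟩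
        evenTerm n i ∎
        where
        s = (- 1#) ^ i
        T = q ^ ((n ∸ suc i) C 2)
        P₁ = qPoch R q q (n ℕ.+ suc i)
        P₂ = qPoch R q q i
        I₁ = Π 1 (n ∸ suc i) inv
        I₂ = Π 1 (2 ℕ.* suc i) inv

      lhs≈evenSum : Σ 1 n (lhsSummand n inv) ≈ evenSum n
      lhs≈evenSum = trans (reflexive (Σ-shift 0 n _)) (Σ-cong 0 n (λ i i<n → lhsSummand≈evenTerm i<n))

    evenRow oddRow : ℕ → Carrier
    evenRow j = sumℤ R (ℤ.1ℤ ℤ.- + j) (+ j) (λ i → q ^ ℤ.∣ + j ℤ.* + j ℤ.- i ℤ.* i ∣)
    oddRow j = sumℤ R (ℤ.- + j) (+ j) (λ i → q ^ ℤ.∣ + j ℤ.* + j ℤ.+ + j ℤ.- i ℤ.* i ℤ.- i ∣)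

    evenRow≈splitSum : ∀ j → evenRow j ≈ splitSum (j ℕ.+ j)
    evenRow≈splitSum j = trans (reflexive (≡.cong (λ L → Σ 0 L term) (countℤ≡ (ℤ.1ℤ ℤ.- + j) (+ j) (width (+ j)))))
                               (Σ-cong 0 (j ℕ.+ j) (λ k k<2j → ^-congʳ q (evenRow-exponent j k k<2j)))
      where
      term : ℕ → Carrier
      term k = let i = ℤ.1ℤ ℤ.- + j ℤ.+ + k in q ^ ℤ.∣ + j ℤ.* + j ℤ.- i ℤ.* i ∣
      width : ∀ (j : ℤ) → (j ℤ.+ ℤ.1ℤ) ℤ.- (ℤ.1ℤ ℤ.- j) ≡ j ℤ.+ j
      width = ℤ-solve-∀

    oddRow≈splitSum : ∀ j → oddRow j ≈ splitSum (suc (j ℕ.+ j))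
    oddRow≈splitSum j = trans (reflexive (≡.cong (λ L → Σ 0 L term) (countℤ≡ (ℤ.- + j) (+ j) (width (+ j)))))
                              (Σ-cong 0 (suc (j ℕ.+ j)) (λ k k<1+2j → ^-congʳ q (oddRow-exponent j k (ℕ.≤-pred k<1+2j))))
      where
      term : ℕ → Carrier
      term k = let i = ℤ.- + j ℤ.+ + k in q ^ ℤ.∣ + j ℤ.* + j ℤ.+ + j ℤ.- i ℤ.* i ℤ.- i ∣
      width : ∀ (j : ℤ) → (j ℤ.+ ℤ.1ℤ) ℤ.- (ℤ.- j) ≡ ℤ.1ℤ ℤ.+ (j ℤ.+ j)
      width = ℤ-solve-∀

    cumulativeSplitSum-odd : ∀ m → cumulativeSplitSum (suc (m ℕ.+ m)) ≈ Σ 0 (suc m) evenRow + Σ 0 (suc m) oddRow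
    cumulativeSplitSum-even : ∀ m → cumulativeSplitSum (suc (suc (m ℕ.+ m))) ≈ Σ 0 (suc (suc m)) evenRow + Σ 0 (suc m) oddRow

    cumulativeSplitSum-odd zero = begin
      splitSum 1 + 0#                         ≈⟨ +-identityʳ _ ⟩
      splitSum 1                              ≈⟨ sym (+-identityˡ _) ⟩
      0# + splitSum 1                         ≈⟨ sym (+-cong (trans (+-identityʳ _) (evenRow≈splitSum 0)) (trans (+-identityʳ _) (oddRow≈splitSum 0))) ⟩
      (evenRow 0 + 0#) + (oddRow 0 + 0#)      ∎
    cumulativeSplitSum-odd (suc m) = begin
      cumulativeSplitSum (suc (suc m ℕ.+ suc m))
        ≡⟨ ≡.cong (λ k → cumulativeSplitSum (suc (suc k))) (ℕ.+-suc m m) ⟩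
      cumulativeSplitSum (suc (suc (suc (m ℕ.+ m))))
        ≈⟨ Σ-snoc 0 (suc (suc (m ℕ.+ m))) _ ⟩
      cumulativeSplitSum (suc (suc (m ℕ.+ m))) + splitSum (suc (suc (suc (m ℕ.+ m))))
        ≈⟨ +-cong (cumulativeSplitSum-even m) (sym (trans (oddRow≈splitSum (suc m)) (reflexive (≡.cong (λ k → splitSum (suc (suc k))) (ℕ.+-suc m m))))) ⟩
      (Σ 0 (suc (suc m)) evenRow + Σ 0 (suc m) oddRow) + oddRow (suc m)
        ≈⟨ trans (+-assoc _ _ _) (+-congˡ (sym (Σ-snoc 0 (suc m) oddRow))) ⟩
      Σ 0 (suc (suc m)) evenRow + Σ 0 (suc (suc m)) oddRow ∎
    cumulativeSplitSum-even m = begin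
      cumulativeSplitSum (suc (suc (m ℕ.+ m)))
        ≈⟨ Σ-snoc 0 (suc (m ℕ.+ m)) _ ⟩
      cumulativeSplitSum (suc (m ℕ.+ m)) + splitSum (suc (suc (m ℕ.+ m)))
        ≈⟨ +-cong (cumulativeSplitSum-odd m) (sym (trans (evenRow≈splitSum (suc m)) (reflexive (≡.cong (λ k → splitSum (suc k)) (ℕ.+-suc m m))))) ⟩
      (Σ 0 (suc m) evenRow + Σ 0 (suc m) oddRow) + evenRow (suc m)
        ≈⟨ solve 3 (λ a b c → (a :+ b) :+ c := (a :+ c) :+ b) refl _ _ _ ⟩
      (Σ 0 (suc m) evenRow + evenRow (suc m)) + Σ 0 (suc m) oddRow
        ≈⟨ +-congʳ (sym (Σ-snoc 0 (suc m) evenRow)) ⟩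
      Σ 0 (suc (suc m)) evenRow + Σ 0 (suc m) oddRow ∎

    rhs≈cumulativeSplitSum : ∀ n → 1 ≤ n →
      sumFromTo R 0 (n / 2) evenRow + sumFromTo R 0 ((n ∸ 1) / 2) oddRow ≈ cumulativeSplitSum n
    rhs≈cumulativeSplitSum n 1≤n with even-or-odd n
    rhs≈cumulativeSplitSum .0 () | zero , inj₁ ≡.refl
    rhs≈cumulativeSplitSum .(suc m ℕ.+ suc m) _ | suc m , inj₁ ≡.refl = begin
      Σ 0 (suc ((suc m ℕ.+ suc m) / 2)) evenRow + Σ 0 (suc ((m ℕ.+ suc m) / 2)) oddRow
        ≡⟨ ≡.cong₂ (λ a b → Σ 0 (suc a) evenRow + Σ 0 (suc b) oddRow) ([m+m]/2≡m (suc m)) (≡.trans (/-congˡ {o = 2} (ℕ.+-suc m m)) ([1+m+m]/2≡m m)) ⟩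
      Σ 0 (suc (suc m)) evenRow + Σ 0 (suc m) oddRow
        ≈⟨ sym (cumulativeSplitSum-even m) ⟩
      cumulativeSplitSum (suc (suc (m ℕ.+ m)))
        ≡⟨ ≡.cong (λ k → cumulativeSplitSum (suc k)) (≡.sym (ℕ.+-suc m m)) ⟩
      cumulativeSplitSum (suc m ℕ.+ suc m) ∎
    rhs≈cumulativeSplitSum .(suc (m ℕ.+ m)) _ | m , inj₂ ≡.refl = begin
      Σ 0 (suc (suc (m ℕ.+ m) / 2)) evenRow + Σ 0 (suc ((m ℕ.+ m) / 2)) oddRow
        ≡⟨ ≡.cong₂ (λ a b → Σ 0 (suc a) evenRow + Σ 0 (suc b) oddRow) ([1+m+m]/2≡m m) ([m+m]/2≡m m) ⟩
      Σ 0 (suc m) evenRow + Σ 0 (suc m) oddRow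
        ≈⟨ sym (cumulativeSplitSum-odd m) ⟩
      cumulativeSplitSum (suc (m ℕ.+ m)) ∎

lemma4p2 : {c ℓ : Level} (R : CommutativeRing c ℓ) →
    let open CommutativeRing R in
    (n : ℕ) → 1 ≤ n → (q : Carrier) → (inv : ℕ → Carrier) →
    ((k : ℕ) → 1 ≤ k → k ≤ 2 ℕ.* n → (1# - pow R q k) * inv k ≈ 1#) →
    sumFromTo R 1 n (λ j →
        pow R (- 1#) (j ∸ 1) * pow R q ((n ∸ j) C 2)
        * qPoch R q q (n ℕ.+ j) * qPoch R q q (j ∸ 1)
        * prodLen R 1 (n ∸ j) inv * prodLen R 1 (2 ℕ.* j) inv)
    ≈ pow R q (n C 2) *
      (sumFromTo R 0 (n / 2) (λ j →
          sumℤ R (ℤ.1ℤ ℤ.- ℤ.+ j) (ℤ.+ j) (λ i →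
            pow R q ℤ.∣ ℤ.+ j ℤ.* ℤ.+ j ℤ.- i ℤ.* i ∣))
       + sumFromTo R 0 ((n ∸ 1) / 2) (λ j →
          sumℤ R (ℤ.- ℤ.+ j) (ℤ.+ j) (λ i →
            pow R q ℤ.∣ ℤ.+ j ℤ.* ℤ.+ j ℤ.+ ℤ.+ j ℤ.- i ℤ.* i ℤ.- i ∣)))
lemma4p2 R n 1≤n q inv inverse = begin
  _                                                  ≈⟨ lhs≈evenSum R q n inv inverse ⟩
  evenSum R q n                                      ≈⟨ evenSum-closed R q n ⟩
  pow R q (triangular n) * cumulativeSplitSum R q n  ≈⟨ *-cong (^-congʳ R q (≡.sym (nC2≡triangular n)))
                                                               (sym (rhs≈cumulativeSplitSum R q n 1≤n)) ⟩
  _                                                  ∎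
  where
  open CommutativeRing R
  open import Relation.Binary.Reasoning.Setoid setoid
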